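{- Let $d \geq 2$ be an integer and let $(r_1, \ldots, r_{d+1}) \in \mathbb{Q}^{d+1}$ satisfy $0 \leq r_1 \leq r_2 \leq \cdots \leq r_{d+1} \leq 1$, where $\sum_{i=1}^{d+1} r_i$ is an integer greater than $1$. Then \[ \max\left\{ \sum_{j=1}^{l} r_{i_j} \;:\; 2 \leq l \leq d,\ 1 \leq i_1 < i_2 < \cdots < i_l \leq d+1,\ \sum_{j=1}^{l-1} r_{i_j} \leq 1 \right\} \geq 1 + \frac{1}{d+1}. \] -}

module Defs where

open import Data.Nat using (ℕ; zero; suc)
open import Data.Fin using (Fin; zero; suc; inject₁)
open import Data.Rational using (ℚ; 0ℚ; _+_)

sumℚ : ∀ {n} → (Fin n → ℚ) → ℚ
sumℚ {zero}  f = 0ℚ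
sumℚ {suc n} f = f zero + sumℚ (λ j → f (suc j))

sumInit : ∀ {n} → (Fin n → ℚ) → ℚ
sumInit {zero}  f = 0ℚ
sumInit {suc n} f = sumℚ (λ j → f (inject₁ j))

module Submission where

-- Put a = r_{d+1} and ε = 1/(d+1); candidates are a run of consecutive r_i of mass ≤ 1 followed by a.
-- Cut the sequence greedily from the right into blocks, each as long as possible subject to its mass
-- without its last element being ≤ 1. If that part together with a is never a candidate, every block
-- has mass in (1, 1 + ε), so b blocks have mass in (b, b + bε] ⊆ (b, b + 1), which an integer total S
-- cannot fill exactly. The remaining prefix therefore carries the missing mass, and the prefix (or the
-- prefix without its last element) together with a ≥ S/(d+1) is a candidate; when the prefix is
-- everything but a, the pair r_d, a is.

open import Defs
open import Data.Nat using (ℕ; suc; _≤_)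
open import Data.Fin using (Fin) renaming (_<_ to _<ᶠ_; _≤_ to _≤ᶠ_)
open import Data.Integer using (ℤ; +_)
open import Data.Rational using (ℚ; 0ℚ; 1ℚ; _+_; _/_) renaming (_≤_ to _≤ℚ_; _<_ to _<ℚ_)
open import Data.Product using (Σ; _×_)
open import Relation.Binary.PropositionalEquality using (_≡_)

open import Data.Nat using (zero; _<_; pred; z≤n; s≤s)
import Data.Nat as ℕ
import Data.Nat.Properties as ℕ
open import Data.Nat.Induction using (<-wellFounded)
open import Data.Nat.Solver renaming (module +-*-Solver to ℕ-Solver)
import Data.Integer as ℤ
import Data.Integer.Properties as ℤ
open import Data.Fin using (zero; suc; toℕ; fromℕ; inject₁)
import Data.Fin.Properties as Fin
open import Data.Rational using (_*_; -_; 1/_; *≤*; *<*; Positive; NonNegative; positive; nonNegative)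
open import Data.Rational.Properties
open import Data.Rational.Literals using (fromℤ)
open import Data.Rational.Solver renaming (module +-*-Solver to ℚ-Solver)
open import Data.Product using (_,_)
open import Data.Sum using (_⊎_; inj₁; inj₂; [_,_]′)
import Data.Sum as Sum
open import Data.Unit using (⊤; tt)
open import Data.Empty using (⊥-elim)
open import Function using (id; _∘_)
open import Induction.WellFounded using (Acc; acc)
open import Relation.Nullary using (yes; no; ¬_)
open import Relation.Binary.PropositionalEquality using (refl; sym; trans; cong; cong₂; subst; subst₂; module ≡-Reasoning)

ι : ℕ → ℚ
ι n = fromℤ (+ n)

ι-suc : ∀ n → ι (suc n) ≡ 1ℚ + ι n
ι-suc n = trans (sym (↥p/↧p≡p (ι (suc n))))
  (/-cong {p₂ = (+ 1) ℤ.* (+ 1) ℤ.+ (+ n) ℤ.* (+ 1)} {q₂ = 1}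
    (cong (ℤ._+_ (+ 1)) (sym (ℤ.*-identityʳ (+ n)))) refl)

ι-suc-* : ∀ n c → ι (suc n) * c ≡ c + ι n * c
ι-suc-* n c = begin
  ι (suc n) * c       ≡⟨ cong (_* c) (ι-suc n) ⟩
  (1ℚ + ι n) * c      ≡⟨ *-distribʳ-+ c 1ℚ (ι n) ⟩
  1ℚ * c + ι n * c    ≡⟨ cong (_+ ι n * c) (*-identityˡ c) ⟩
  c + ι n * c         ∎
  where open ≡-Reasoning

ι-mono-< : ∀ {m n} → m < n → ι m <ℚ ι n
ι-mono-< {m} {n} m<n =
  *<* (subst₂ ℤ._<_ (sym (ℤ.*-identityʳ (+ m))) (sym (ℤ.*-identityʳ (+ n))) (ℤ.+<+ m<n))

ι-mono-≤ : ∀ {m n} → m ≤ n → ι m ≤ℚ ι n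
ι-mono-≤ {m} {n} m≤n =
  *≤* (subst₂ ℤ._≤_ (sym (ℤ.*-identityʳ (+ m))) (sym (ℤ.*-identityʳ (+ n))) (ℤ.+≤+ m≤n))

≤⇒≯ : ∀ {x y} → x ≤ℚ y → ¬ (y <ℚ x)
≤⇒≯ x≤y y<x = <-irrefl refl (≤-<-trans x≤y y<x)

+-cancelʳ-≤ : ∀ x y z → x + z ≤ℚ y + z → x ≤ℚ y
+-cancelʳ-≤ x y z = subst₂ _≤ℚ_ (cancel x) (cancel y) ∘ +-monoˡ-≤ (- z)
  where
  open ℚ-Solver
  cancel : ∀ u → (u + z) + - z ≡ u
  cancel u = solve 2 (λ u z → (u :+ z) :+ (:- z) := u) refl u z

IsInteger : ℚ → Set
IsInteger x = Σ ℤ λ k → x ≡ fromℤ k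

ι<integer⇒ι-suc≤ : ∀ {n x} → IsInteger x → ι n <ℚ x → ι (suc n) ≤ℚ x
ι<integer⇒ι-suc≤ {n} (k , refl) (*<* p) with subst₂ ℤ._<_ (ℤ.*-identityʳ (+ n)) (ℤ.*-identityʳ k) p
... | ℤ.+<+ n<m = ι-mono-≤ n<m

module Reciprocal (n : ℕ) where

  ε : ℚ
  ε = + 1 / suc n

  ε≡1/ι : ε ≡ 1/ ι (suc n)
  ε≡1/ι = ↥p/↧p≡p (1/ ι (suc n))

  ι*ε≡1 : ι (suc n) * ε ≡ 1ℚ
  ι*ε≡1 = trans (cong (ι (suc n) *_) ε≡1/ι) (*-inverseʳ (ι (suc n)))

  0<ε : 0ℚ <ℚ ε
  0<ε = subst (0ℚ <ℚ_) (sym ε≡1/ι) (*<* (ℤ.+<+ (s≤s z≤n)))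

  instance
    ε-positive : Positive ε
    ε-positive = positive 0<ε

    ε-nonNegative : NonNegative ε
    ε-nonNegative = nonNegative (<⇒≤ 0<ε)

  *-[1+ε] : ∀ x → x * (1ℚ + ε) ≡ x + x * ε
  *-[1+ε] x = trans (*-distribˡ-+ x 1ℚ ε) (cong (_+ x * ε) (*-identityʳ x))

  ι*[1+ε]<ι-suc : ∀ {b} → b < suc n → ι b * (1ℚ + ε) <ℚ ι (suc b)
  ι*[1+ε]<ι-suc {b} b<n = begin-strict
    ι b * (1ℚ + ε)  ≡⟨ *-[1+ε] (ι b) ⟩
    ι b + ι b * ε   <⟨ +-monoʳ-< (ι b) bε<1 ⟩
    ι b + 1ℚ        ≡⟨ +-comm (ι b) 1ℚ ⟩
    1ℚ + ι b        ≡⟨ sym (ι-suc b) ⟩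
    ι (suc b)       ∎
    where
    open ≤-Reasoning
    bε<1 : ι b * ε <ℚ 1ℚ
    bε<1 = subst (ι b * ε <ℚ_) ι*ε≡1 (*-monoˡ-<-pos ε (ι-mono-< b<n))

  ¬IsInteger-between : ∀ {b x} → b < suc n → ι b <ℚ x → x ≤ℚ ι b * (1ℚ + ε) → ¬ IsInteger x
  ¬IsInteger-between b<n b<x x≤ x-int =
    ≤⇒≯ (ι<integer⇒ι-suc≤ x-int b<x) (≤-<-trans x≤ (ι*[1+ε]<ι-suc b<n))

  ≤ι*⇒ε*≤ : ∀ {x c} → x ≤ℚ ι (suc n) * c → ε * x ≤ℚ c
  ≤ι*⇒ε*≤ {x} {c} x≤ = begin
    ε * x                ≤⟨ *-monoˡ-≤-nonNeg ε x≤ ⟩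
    ε * (ι (suc n) * c)  ≡⟨ sym (*-assoc ε (ι (suc n)) c) ⟩
    ε * ι (suc n) * c    ≡⟨ cong (_* c) (trans (*-comm ε (ι (suc n))) ι*ε≡1) ⟩
    1ℚ * c               ≡⟨ *-identityˡ c ⟩
    c                    ∎
    where open ≤-Reasoning

  1+ε≤ρ+a : ∀ {B ρ m a} → ι (suc B) ≤ℚ ρ + m → m ≤ℚ ι B * (1ℚ + ε) → ε * ι (suc B) ≤ℚ a
          → 1ℚ + ε ≤ℚ ρ + a
  1+ε≤ρ+a {B} {ρ} {m} {a} B+1≤ρ+m m≤ ε[B+1]≤a = +-cancelʳ-≤ (1ℚ + ε) (ρ + a) (ι B * (1ℚ + ε)) (begin
    1ℚ + ε + ι B * (1ℚ + ε)
      ≡⟨ solve 2 (λ e b → con 1ℚ :+ e :+ b :* (con 1ℚ :+ e) := (con 1ℚ :+ b) :+ e :* (con 1ℚ :+ b)) refl ε (ι B) ⟩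
    (1ℚ + ι B) + ε * (1ℚ + ι B)   ≡⟨ cong₂ (λ u v → u + ε * v) (sym (ι-suc B)) (sym (ι-suc B)) ⟩
    ι (suc B) + ε * ι (suc B)     ≤⟨ +-mono-≤ B+1≤ρ+m ε[B+1]≤a ⟩
    ρ + m + a                     ≤⟨ +-monoˡ-≤ a (+-monoʳ-≤ ρ m≤) ⟩
    ρ + ι B * (1ℚ + ε) + a
      ≡⟨ solve 3 (λ r x z → r :+ x :+ z := r :+ z :+ x) refl ρ (ι B * (1ℚ + ε)) a ⟩
    ρ + a + ι B * (1ℚ + ε)        ∎)
    where
    open ≤-Reasoning
    open ℚ-Solver

sumℚ-cong : ∀ {n} {f g : Fin n → ℚ} → (∀ j → f j ≡ g j) → sumℚ f ≡ sumℚ g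
sumℚ-cong {zero}  _   = refl
sumℚ-cong {suc n} f≡g = cong₂ _+_ (f≡g zero) (sumℚ-cong (λ j → f≡g (suc j)))

module Segments (y : ℕ → ℚ) where

  seg : ℕ → ℕ → ℚ
  seg s zero    = 0ℚ
  seg s (suc t) = y s + seg (suc s) t

  seg-+ : ∀ s t u → seg s (t ℕ.+ u) ≡ seg s t + seg (s ℕ.+ t) u
  seg-+ s zero    u = sym (trans (+-identityˡ _) (cong (λ v → seg v u) (ℕ.+-identityʳ s)))
  seg-+ s (suc t) u = begin
    y s + seg (suc s) (t ℕ.+ u)                       ≡⟨ cong (_+_ (y s)) (seg-+ (suc s) t u) ⟩
    y s + (seg (suc s) t + seg (suc s ℕ.+ t) u)       ≡⟨ sym (+-assoc (y s) _ _) ⟩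
    y s + seg (suc s) t + seg (suc s ℕ.+ t) u
      ≡⟨ cong (λ v → y s + seg (suc s) t + seg v u) (sym (ℕ.+-suc s t)) ⟩
    y s + seg (suc s) t + seg (s ℕ.+ suc t) u         ∎
    where open ≡-Reasoning

  seg-snoc : ∀ s t → seg s (suc t) ≡ seg s t + y (s ℕ.+ t)
  seg-snoc s t = trans (cong (seg s) (ℕ.+-comm 1 t))
    (trans (seg-+ s t 1) (cong (_+_ (seg s t)) (+-identityʳ (y (s ℕ.+ t)))))

  seg-nonneg : (∀ i → 0ℚ ≤ℚ y i) → ∀ s t → 0ℚ ≤ℚ seg s t
  seg-nonneg y≥0 s zero    = ≤-refl
  seg-nonneg y≥0 s (suc t) = +-mono-≤ (y≥0 s) (seg-nonneg y≥0 (suc s) t)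

  seg-≤-ι* : ∀ c s t → (∀ i → i < s ℕ.+ t → y i ≤ℚ c) → seg s t ≤ℚ ι t * c
  seg-≤-ι* c s zero    _ = ≤-reflexive (sym (*-zeroˡ c))
  seg-≤-ι* c s (suc t) y≤c = subst (seg s (suc t) ≤ℚ_) (sym (ι-suc-* t c))
    (+-mono-≤ (y≤c s (subst (s <_) (sym (ℕ.+-suc s t)) (s≤s (ℕ.m≤m+n s t))))
              (seg-≤-ι* c (suc s) t (λ i i< → y≤c i (subst (i <_) (sym (ℕ.+-suc s t)) i<))))

  sumℚ≡seg : ∀ t s → sumℚ {t} (λ j → y (s ℕ.+ toℕ j)) ≡ seg s t
  sumℚ≡seg zero    s = refl
  sumℚ≡seg (suc t) s = cong₂ _+_ (cong y (ℕ.+-identityʳ s))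
    (trans (sumℚ-cong {t} (λ j → cong y (ℕ.+-suc s (toℕ j)))) (sumℚ≡seg t (suc s)))

  Unextendable : ℚ → ℕ → ℕ → Set
  Unextendable c zero    t = ⊤
  Unextendable c (suc s) t = c <ℚ seg s (suc t)

  record LeftMaximal (c : ℚ) (e t₀ : ℕ) : Set where
    constructor leftMaximal
    field
      start len    : ℕ
      ends         : start ℕ.+ len ≡ e
      t₀≤len       : t₀ ≤ len
      seg≤c        : seg start len ≤ℚ c
      unextendable : Unextendable c start len

  extendˡ : ∀ c s t → seg s t ≤ℚ c → LeftMaximal c (s ℕ.+ t) t
  extendˡ c zero    t seg≤c = leftMaximal zero t refl ℕ.≤-refl seg≤c tt
  extendˡ c (suc s) t seg≤c with seg s (suc t) ≤? c
  ... | no  over = leftMaximal (suc s) t refl ℕ.≤-refl seg≤c (≰⇒> over)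
  ... | yes fits with extendˡ c s (suc t) fits
  ...   | leftMaximal s′ t′ ends t<t′ seg≤c′ unext =
          leftMaximal s′ t′ (trans ends (ℕ.+-suc s t)) (ℕ.<⇒≤ t<t′) seg≤c′ unext

module Candidates (d : ℕ) (y : ℕ → ℚ) where

  open Segments y public
  open Reciprocal d public

  a : ℚ
  a = y d

  -- The index set [start, start + width) ∪ {d} of the theorem.
  record GoodSegment : Set where
    constructor goodSegment
    field
      start width : ℕ
      1≤width     : 1 ≤ width
      width<d     : width < d
      fits        : start ℕ.+ width ≤ d
      seg≤1       : seg start width ≤ℚ 1ℚ
      1+ε≤seg+a   : 1ℚ + ε ≤ℚ seg start width + a

  try : ∀ s w → 1 ≤ w → w < d → s ℕ.+ w ≤ d → seg s w ≤ℚ 1ℚ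
      → GoodSegment ⊎ seg s w + a <ℚ 1ℚ + ε
  try s w 1≤w w<d fits seg≤1 with 1ℚ + ε ≤? seg s w + a
  ... | yes reach = inj₁ (goodSegment s w 1≤w w<d fits seg≤1 reach)
  ... | no  short = inj₂ (≰⇒> short)

module Argument (d : ℕ) (2≤d : 2 ≤ d) (y : ℕ → ℚ)
  (y≥0 : ∀ i → 0ℚ ≤ℚ y i) (y≤1 : ∀ i → y i ≤ℚ 1ℚ)
  (y-mono : ∀ {i j} → i ≤ j → y i ≤ℚ y j) (y≤a : ∀ i → y i ≤ℚ y d) where

  open Candidates d y

  P : ℕ → ℚ
  P = seg 0

  S : ℚ
  S = P (suc d)

  seg-slide : ∀ s t → seg s (suc t) ≤ℚ seg (suc s) (suc t)
  seg-slide s t = subst₂ _≤ℚ_ (+-comm (seg (suc s) t) (y s)) (sym (seg-snoc (suc s) t))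
    (+-monoʳ-≤ (seg (suc s) t) (y-mono (ℕ.m≤n⇒m≤1+n (ℕ.m≤m+n s t))))

  seg-snoc-≤ : ∀ s t → seg s (suc t) ≤ℚ seg s t + a
  seg-snoc-≤ s t = subst (_≤ℚ seg s t + a) (sym (seg-snoc s t)) (+-monoʳ-≤ (seg s t) (y≤a _))

  -- [j, k) is cut into b consecutive blocks of length ≥ 2 and mass in (1, 1 + ε), of total mass m;
  -- the cutting stopped at j because P (j - 1) ≤ 1.
  record Decomposition (k : ℕ) : Set where
    constructor decomposition
    field
      j b          : ℕ
      m            : ℚ
      room         : j ℕ.+ (b ℕ.+ b) ≤ k
      prefix≤1     : P (pred j) ≤ℚ 1ℚ
      split        : P k ≡ P j + m
      ι≤m          : ι b ≤ℚ m
      empty-or-ι<m : b ≡ 0 ⊎ ι b <ℚ m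
      m≤           : m ≤ℚ ι b * (1ℚ + ε)

  no-blocks : ∀ k → P (pred k) ≤ℚ 1ℚ → Decomposition k
  no-blocks k P≤1 = decomposition k 0 0ℚ (ℕ.≤-reflexive (ℕ.+-identityʳ k)) P≤1
    (sym (+-identityʳ (P k))) ≤-refl (inj₁ refl) (≤-reflexive (sym (*-zeroˡ (1ℚ + ε))))

  add-block : ∀ s t → Decomposition s → 2 ≤ t → 1ℚ <ℚ seg s t → seg s t <ℚ 1ℚ + ε
            → Decomposition (s ℕ.+ t)
  add-block s t (decomposition j b m room P≤1 split ι≤m _ m≤) 2≤t 1<seg seg<1+ε =
    decomposition j (suc b) (seg s t + m) room′ P≤1 split′
      (subst (_≤ℚ seg s t + m) (sym (ι-suc b)) (+-mono-≤ (<⇒≤ 1<seg) ι≤m))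
      (inj₂ (subst (_<ℚ seg s t + m) (sym (ι-suc b)) (+-mono-<-≤ 1<seg ι≤m)))
      (subst (seg s t + m ≤ℚ_) (sym (ι-suc-* b (1ℚ + ε))) (+-mono-≤ (<⇒≤ seg<1+ε) m≤))
    where
    open ℕ-Solver
    room′ : j ℕ.+ (suc b ℕ.+ suc b) ≤ s ℕ.+ t
    room′ = subst (_≤ s ℕ.+ t)
      (solve 2 (λ j b → j :+ (b :+ b) :+ con 2 := j :+ ((con 1 :+ b) :+ (con 1 :+ b))) refl j b)
      (ℕ.+-mono-≤ room 2≤t)
    split′ : P (s ℕ.+ t) ≡ P j + (seg s t + m)
    split′ = begin
      P (s ℕ.+ t)        ≡⟨ seg-+ 0 s t ⟩
      P s + seg s t      ≡⟨ cong (_+ seg s t) split ⟩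
      P j + m + seg s t  ≡⟨ +-assoc (P j) m (seg s t) ⟩
      P j + (m + seg s t) ≡⟨ cong (_+_ (P j)) (+-comm m (seg s t)) ⟩
      P j + (seg s t + m) ∎
      where open ≡-Reasoning

  -- Greedily cut off, from the right, the longest block whose mass without its last element is ≤ 1.
  decompose : ∀ k → Acc _<_ k → k ≤ suc d → GoodSegment ⊎ Decomposition k
  decompose k _ _ with P (pred k) ≤? 1ℚ
  ... | yes P≤1 = inj₂ (no-blocks k P≤1)
  decompose zero          _         _  | no P≰1 = ⊥-elim (P≰1 (*≤* (ℤ.+≤+ z≤n)))
  decompose (suc zero)    _         _  | no P≰1 = ⊥-elim (P≰1 (*≤* (ℤ.+≤+ z≤n)))
  decompose (suc (suc e)) (acc rec) k≤ | no P≰1 =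
    cut (extendˡ 1ℚ e 1 (subst (_≤ℚ 1ℚ) (sym (+-identityʳ (y e))) (y≤1 e)))
    where
    cut : LeftMaximal 1ℚ (e ℕ.+ 1) 1 → GoodSegment ⊎ Decomposition (suc (suc e))
    cut (leftMaximal zero t ends _ seg≤1 _) =
      ⊥-elim (P≰1 (subst (λ u → P u ≤ℚ 1ℚ) (trans ends (ℕ.+-comm e 1)) seg≤1))
    cut (leftMaximal (suc s) t ends 1≤t seg≤1 1<seg) =
      [ inj₁ , add-last-block ]′ (try (suc s) t 1≤t t<d s+t≤d seg≤1)
      where
      ends′ : suc s ℕ.+ t ≡ suc e
      ends′ = trans ends (ℕ.+-comm e 1)
      s+t≤d : suc s ℕ.+ t ≤ d
      s+t≤d = subst (_≤ d) (sym ends′) (ℕ.≤-pred k≤)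
      t<d : t < d
      t<d = ℕ.<-≤-trans (s≤s (ℕ.m≤n+m t s)) s+t≤d
      s<k : suc s < suc (suc e)
      s<k = s≤s (subst (suc s ≤_) ends′ (ℕ.m≤m+n (suc s) t))
      add-last-block : seg (suc s) t + a <ℚ 1ℚ + ε → GoodSegment ⊎ Decomposition (suc (suc e))
      add-last-block short = Sum.map₂
        (λ D → subst Decomposition (trans (ℕ.+-suc (suc s) t) (cong suc ends′))
          (add-block (suc s) (suc t) D (s≤s 1≤t)
            (<-≤-trans 1<seg (seg-slide s t)) (≤-<-trans (seg-snoc-≤ (suc s) t) short)))
        (decompose (suc s) (rec s<k) (ℕ.<⇒≤ (ℕ.<-≤-trans s<k k≤)))

  S≤ι*a : S ≤ℚ ι (suc d) * a
  S≤ι*a = seg-≤-ι* a 0 (suc d) (λ i _ → y≤a i)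

  module _ (S-integer : IsInteger S) (1<S : 1ℚ <ℚ S) where

    -- S ≥ 2 with P d ≤ 1 forces a = 1 and P d = 1, hence y (d - 1) ≥ 1/d ≥ ε.
    last-pair : P d ≤ℚ 1ℚ → GoodSegment
    last-pair Pd≤1 = goodSegment (pred d) 1 (s≤s z≤n) 2≤d d-1+1≤d
      (subst (_≤ℚ 1ℚ) (sym (+-identityʳ c)) (y≤1 (pred d)))
      (subst (1ℚ + ε ≤ℚ_) (trans (+-comm a c) (cong (_+ a) (sym (+-identityʳ c)))) (+-mono-≤ 1≤a ε≤c))
      where
      c : ℚ
      c = y (pred d)
      d-1+1≤d : pred d ℕ.+ 1 ≤ d
      d-1+1≤d = ℕ.≤-reflexive (trans (ℕ.+-comm (pred d) 1)
        (ℕ.suc-pred d {{ℕ.>-nonZero (ℕ.≤-trans (s≤s z≤n) 2≤d)}}))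
      S≡ : S ≡ P d + a
      S≡ = seg-snoc 0 d
      2≤S : 1ℚ + 1ℚ ≤ℚ S
      2≤S = subst (_≤ℚ S) (ι-suc 1) (ι<integer⇒ι-suc≤ S-integer 1<S)
      1≤a : 1ℚ ≤ℚ a
      1≤a = +-cancelʳ-≤ 1ℚ a 1ℚ
        (≤-trans 2≤S (subst₂ _≤ℚ_ (sym S≡) (+-comm 1ℚ a) (+-monoˡ-≤ a Pd≤1)))
      1≤Pd : 1ℚ ≤ℚ P d
      1≤Pd = +-cancelʳ-≤ 1ℚ (P d) 1ℚ
        (≤-trans 2≤S (subst (_≤ℚ P d + 1ℚ) (sym S≡) (+-monoʳ-≤ (P d) (y≤1 d))))
      ι*c≤ : ι d * c ≤ℚ ι (suc d) * c
      ι*c≤ = subst₂ _≤ℚ_ (+-identityˡ (ι d * c)) (sym (ι-suc-* d c))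
        (+-monoˡ-≤ (ι d * c) (y≥0 (pred d)))
      ε≤c : ε ≤ℚ c
      ε≤c = subst (_≤ℚ c) (*-identityʳ ε) (≤ι*⇒ε*≤ (≤-trans 1≤Pd
        (≤-trans (seg-≤-ι* c 0 d (λ i i<d → y-mono (ℕ.suc[m]≤n⇒m≤pred[n] i<d))) ι*c≤)))

    -- Integrality gives S ≥ b + 1, which forces P j ≥ 1 - bε, while a ≥ S/(d+1) ≥ (b + 1) ε.
    prefix-fits : (D : Decomposition (suc d)) → P (Decomposition.j D) ≤ℚ 1ℚ → GoodSegment
    prefix-fits (decomposition j zero m _ _ split _ _ m≤) Pj≤1 = ⊥-elim (≤⇒≯ S≤1 1<S)
      where
      S≤1 : S ≤ℚ 1ℚ
      S≤1 = subst₂ _≤ℚ_ (sym split) (+-identityʳ 1ℚ)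
        (+-mono-≤ Pj≤1 (subst (m ≤ℚ_) (*-zeroˡ (1ℚ + ε)) m≤))
    prefix-fits (decomposition j (suc b) m _ _ _ _ (inj₁ ()) _) _
    prefix-fits (decomposition zero (suc b) m room _ split _ (inj₂ b<m) m≤) _ =
      ⊥-elim (¬IsInteger-between (ℕ.<-≤-trans (ℕ.m<n+m (suc b) (s≤s z≤n)) room) b<m m≤
        (subst IsInteger (trans split (+-identityˡ m)) S-integer))
    prefix-fits (decomposition (suc j) (suc b) m room _ split _ (inj₂ b<m) m≤) Pj≤1 =
      goodSegment 0 (suc j) (s≤s z≤n) j<d (ℕ.<⇒≤ j<d) Pj≤1
        (1+ε≤ρ+a {ρ = P (suc j)} {a = a} (subst (ι (suc (suc b)) ≤ℚ_) split b+2≤S) m≤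
          (≤ι*⇒ε*≤ (≤-trans b+2≤S S≤ι*a)))
      where
      m≤S : m ≤ℚ S
      m≤S = subst₂ _≤ℚ_ (+-identityˡ m) (sym split) (+-monoˡ-≤ m (seg-nonneg y≥0 0 (suc j)))
      b+2≤S : ι (suc (suc b)) ≤ℚ S
      b+2≤S = ι<integer⇒ι-suc≤ S-integer (<-≤-trans b<m m≤S)
      j<d : suc j < d
      j<d = ℕ.≤-pred (subst (_≤ suc d) (ℕ.+-comm (suc j) 2)
        (ℕ.≤-trans (ℕ.+-monoʳ-≤ (suc j) (s≤s (ℕ.≤-trans (s≤s z≤n) (ℕ.m≤n+m (suc b) b)))) room))

    -- Unless [0, j - 1) with a is a candidate, [0, j) is one more block, and S ∈ (b + 1, (b + 1)(1 + ε)].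
    prefix-overflows : (D : Decomposition (suc d)) → 1ℚ <ℚ P (Decomposition.j D) → GoodSegment
    prefix-overflows (decomposition zero _ _ _ _ _ _ _ _) 1<P = ⊥-elim (≤⇒≯ (*≤* (ℤ.+≤+ z≤n)) 1<P)
    prefix-overflows (decomposition (suc zero) _ _ _ _ _ _ _ _) 1<P =
      ⊥-elim (≤⇒≯ (subst (_≤ℚ 1ℚ) (sym (+-identityʳ (y 0))) (y≤1 0)) 1<P)
    prefix-overflows (decomposition (suc (suc j)) b m room P≤1 split ι≤m _ m≤) 1<P
      with suc (suc j) ℕ.≤? d
    ... | yes j≤d = [ id , (λ short → ⊥-elim (S-not-integer short S-integer)) ]′
                      (try 0 (suc j) (s≤s z≤n) j≤d (ℕ.<⇒≤ j≤d) P≤1)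
      where
      b<d : suc b < suc d
      b<d = ℕ.≤-trans (s≤s (s≤s (ℕ.m≤m+n b b)))
        (ℕ.≤-trans (ℕ.+-monoˡ-≤ (b ℕ.+ b) (s≤s (s≤s (z≤n {j})))) room)
      b+1<S : ι (suc b) <ℚ S
      b+1<S = subst₂ _<ℚ_ (sym (ι-suc b)) (sym split) (+-mono-<-≤ 1<P ι≤m)
      S-not-integer : P (suc j) + a <ℚ 1ℚ + ε → ¬ IsInteger S
      S-not-integer short = ¬IsInteger-between b<d b+1<S
        (subst₂ _≤ℚ_ (sym split) (sym (ι-suc-* b (1ℚ + ε)))
          (+-mono-≤ (<⇒≤ (≤-<-trans (seg-snoc-≤ 0 (suc j)) short)) m≤))
    ... | no j≰d = last-pair (subst (λ u → P u ≤ℚ 1ℚ) j≡d P≤1)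
      where
      j≡d : suc j ≡ d
      j≡d = ℕ.suc-injective
        (ℕ.≤-antisym (ℕ.≤-trans (ℕ.m≤m+n (suc (suc j)) (b ℕ.+ b)) room) (ℕ.≰⇒> j≰d))

    good-segment : GoodSegment
    good-segment = [ id , from-decomposition ]′ (decompose (suc d) (<-wellFounded (suc d)) ℕ.≤-refl)
      where
      from-decomposition : Decomposition (suc d) → GoodSegment
      from-decomposition D with P (Decomposition.j D) ≤? 1ℚ
      ... | yes Pj≤1 = prefix-fits D Pj≤1
      ... | no  Pj≰1 = prefix-overflows D (≰⇒> Pj≰1)

clamp : ∀ m → ℕ → Fin (suc m)
clamp zero    _       = zero
clamp (suc m) zero    = zero
clamp (suc m) (suc k) = suc (clamp m k)

clamp-mono : ∀ m {i j} → i ≤ j → clamp m i ≤ᶠ clamp m j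
clamp-mono zero    _         = z≤n
clamp-mono (suc m) z≤n       = z≤n
clamp-mono (suc m) (s≤s i≤j) = s≤s (clamp-mono m i≤j)

toℕ-clamp : ∀ m {k} → k ≤ m → toℕ (clamp m k) ≡ k
toℕ-clamp zero    z≤n       = refl
toℕ-clamp (suc m) z≤n       = refl
toℕ-clamp (suc m) (s≤s k≤m) = cong suc (toℕ-clamp m k≤m)

clamp-toℕ : ∀ m (i : Fin (suc m)) → clamp m (toℕ i) ≡ i
clamp-toℕ zero    zero    = refl
clamp-toℕ (suc m) zero    = refl
clamp-toℕ (suc m) (suc i) = cong suc (clamp-toℕ m i)

clamp-self : ∀ m → clamp m m ≡ fromℕ m
clamp-self zero    = refl
clamp-self (suc m) = cong suc (clamp-self m)

module Padded (d : ℕ) (r : Fin (suc d) → ℚ) where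

  y : ℕ → ℚ
  y k = r (clamp d k)

  open Candidates d y

  segment-then-last : ℕ → ℕ → ℕ → ℕ
  segment-then-last s zero    _       = d
  segment-then-last s (suc w) zero    = s
  segment-then-last s (suc w) (suc k) = segment-then-last (suc s) w k

  segment-then-last-≤ : ∀ s w k → s ℕ.+ w ≤ d → segment-then-last s w k ≤ d
  segment-then-last-≤ s zero    k       _   = ℕ.≤-refl
  segment-then-last-≤ s (suc w) zero    s+w≤d = ℕ.≤-trans (ℕ.m≤m+n s (suc w)) s+w≤d
  segment-then-last-≤ s (suc w) (suc k) s+w≤d =
    segment-then-last-≤ (suc s) w k (subst (_≤ d) (ℕ.+-suc s w) s+w≤d)

  segment-then-last-≥ : ∀ s w k → s ℕ.+ w ≤ d → s ≤ segment-then-last s w k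
  segment-then-last-≥ s zero    k       s+w≤d = ℕ.≤-trans (ℕ.m≤m+n s 0) s+w≤d
  segment-then-last-≥ s (suc w) zero    _     = ℕ.≤-refl
  segment-then-last-≥ s (suc w) (suc k) s+w≤d =
    ℕ.≤-trans (ℕ.n≤1+n s) (segment-then-last-≥ (suc s) w k (subst (_≤ d) (ℕ.+-suc s w) s+w≤d))

  segment-then-last-mono : ∀ s w {k k′} → s ℕ.+ w ≤ d → k < k′ → k′ ≤ w
                         → segment-then-last s w k < segment-then-last s w k′
  segment-then-last-mono s zero    {k′ = zero}   _     ()        _
  segment-then-last-mono s zero    {k′ = suc _}  _     _         ()
  segment-then-last-mono s (suc w) {zero}  {suc k′} s+w≤d _   _ =
    segment-then-last-≥ (suc s) w k′ (subst (_≤ d) (ℕ.+-suc s w) s+w≤d)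
  segment-then-last-mono s (suc w) {suc k} {suc k′} s+w≤d (s≤s k<k′) (s≤s k′≤w) =
    segment-then-last-mono (suc s) w (subst (_≤ d) (ℕ.+-suc s w) s+w≤d) k<k′ k′≤w

  sumℚ-segment-then-last : ∀ s w → sumℚ {suc w} (λ j → y (segment-then-last s w (toℕ j))) ≡ seg s w + a
  sumℚ-segment-then-last s zero    = trans (+-identityʳ a) (sym (+-identityˡ a))
  sumℚ-segment-then-last s (suc w) = trans (cong (_+_ (y s)) (sumℚ-segment-then-last (suc s) w))
    (sym (+-assoc (y s) (seg (suc s) w) a))

  sumInit-segment-then-last : ∀ s w
    → sumℚ {w} (λ j → y (segment-then-last s w (toℕ (inject₁ j)))) ≡ seg s w
  sumInit-segment-then-last s zero    = refl
  sumInit-segment-then-last s (suc w) = cong (_+_ (y s)) (sumInit-segment-then-last (suc s) w)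

  sumℚ-r≡seg : sumℚ r ≡ seg 0 (suc d)
  sumℚ-r≡seg = trans (sumℚ-cong (λ j → cong r (sym (clamp-toℕ d j)))) (sumℚ≡seg (suc d) 0)

  from-good-segment : GoodSegment → Σ ℕ λ l → 2 ≤ l × l ≤ d × Σ (Fin l → Fin (suc d)) λ i →
      (∀ a b → a <ᶠ b → i a <ᶠ i b)
      × sumInit (λ j → r (i j)) ≤ℚ 1ℚ
      × 1ℚ + (+ 1) / (suc d) ≤ℚ sumℚ (λ j → r (i j))
  from-good-segment (goodSegment s w 1≤w w<d s+w≤d seg≤1 1+ε≤) =
    suc w , s≤s 1≤w , w<d , i , i-increasing
      , subst (_≤ℚ 1ℚ) (sym (sumInit-segment-then-last s w)) seg≤1
      , subst (1ℚ + ε ≤ℚ_) (sym (sumℚ-segment-then-last s w)) 1+ε≤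
    where
    i : Fin (suc w) → Fin (suc d)
    i j = clamp d (segment-then-last s w (toℕ j))
    toℕ-i : ∀ j → toℕ (i j) ≡ segment-then-last s w (toℕ j)
    toℕ-i j = toℕ-clamp d (segment-then-last-≤ s w (toℕ j) s+w≤d)
    i-increasing : ∀ j j′ → j <ᶠ j′ → i j <ᶠ i j′
    i-increasing j j′ j<j′ = subst₂ _<_ (sym (toℕ-i j)) (sym (toℕ-i j′))
      (segment-then-last-mono s w s+w≤d j<j′ (Fin.toℕ≤pred[n] j′))

lemma2p3 : (d : ℕ) → 2 ≤ d → (r : Fin (suc d) → ℚ)
    → (∀ a → 0ℚ ≤ℚ r a) → (∀ a → r a ≤ℚ 1ℚ)
    → (∀ a b → a ≤ᶠ b → r a ≤ℚ r b)
    → (Σ ℤ λ k → sumℚ r ≡ k / 1) → 1ℚ <ℚ sumℚ r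
    → Σ ℕ λ l → 2 ≤ l × l ≤ d × Σ (Fin l → Fin (suc d)) λ i →
    (∀ a b → a <ᶠ b → i a <ᶠ i b)
    × sumInit (λ j → r (i j)) ≤ℚ 1ℚ
    × 1ℚ + (+ 1) / (suc d) ≤ℚ sumℚ (λ j → r (i j))
lemma2p3 d 2≤d r r≥0 r≤1 r-mono (k , Σr≡k) 1<Σr = from-good-segment
  (Argument.good-segment d 2≤d y (r≥0 ∘ clamp d) (r≤1 ∘ clamp d)
    (λ i≤j → r-mono _ _ (clamp-mono d i≤j)) y≤y-last
    (k , trans (sym sumℚ-r≡seg) (trans Σr≡k (↥p/↧p≡p (fromℤ k))))
    (subst (1ℚ <ℚ_) sumℚ-r≡seg 1<Σr))
  where
  open Padded d r
  y≤y-last : ∀ i → y i ≤ℚ y d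
  y≤y-last i = subst (λ x → y i ≤ℚ r x) (sym (clamp-self d)) (r-mono _ _ (Fin.≤fromℕ _))
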